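{- For every instance $(n,i,j)$ of the weighted Tower of Hanoi, the solution produced by the algorithm WTHD$(n,i,j)$ (defined in the context) is an optimal solution, and among all optimal solutions of that instance it has the minimum number of moves.
   Context: Weighted Tower of Hanoi (WTH): three pegs $1,2,3$, $n\in\mathbb{N}_0$ discs of pairwise distinct diameters. A legal move takes the topmost disc of a peg $a$ to a different peg $b$ which is empty or whose topmost disc is larger; it costs $w_{ab}\ge 0$. An instance $(n,i,j)$, $i\neq j$, asks to transfer all $n$ discs from peg $i$ (initially stacked there) to peg $j$; a solution is a finite sequence of legal moves achieving this, its total cost is the sum of its move costs, and an optimal solution has minimum total cost. $C_n^{i,j}$ is the optimal total cost ($C_0^{i,j}=0$), and $k=6-i-j$ denotes the third peg. Let $d_n$ denote the largest of the discs currently being transferred. Algorithm WTHD$(n,i,j)$, with $k=6-i-j$: if $n=1$: if $w_{ij}\le w_{ik}+w_{kj}$, move the disc from $i$ to $j$; otherwise move it from $i$ to $k$ and then from $k$ to $j$. If $n\ge 2$: if $C_{n-1}^{i,k}+C_{n-1}^{k,j}+w_{ij}\le 2C_{n-1}^{i,j}+C_{n-1}^{j,i}+w_{ik}+w_{kj}$, run WTHD$(n-1,i,k)$, move $d_n$ from $i$ to $j$, run WTHD$(n-1,k,j)$; otherwise run WTHD$(n-1,i,j)$, move $d_n$ from $i$ to $k$, run WTHD$(n-1,j,i)$, move $d_n$ from $k$ to $j$, run WTHD$(n-1,i,j)$.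
   Formalization: The move weights $w_{ab}$ are nonnegative rationals, so the total costs and the optimal costs $C_n^{i,j}$ are rational as well. -}

module Defs where

open import Data.Nat using (ℕ; zero; suc)
open import Data.Fin using (Fin; zero; suc; _<_)
open import Data.Vec using (Vec; replicate; lookup; _[_]≔_)
open import Data.List using (List; []; _∷_; _++_; length)
open import Data.Product using (_×_; _,_; Σ; ∃)
open import Data.Rational using (ℚ; 0ℚ; _+_; _≤_)
open import Data.Rational.Properties using (_≤?_)
open import Relation.Nullary using (yes; no; ¬_; does)
open import Data.Bool using (if_then_else_)
open import Relation.Binary.PropositionalEquality using (_≡_; _≢_)

-- Pegs 1,2,3 are represented by Fin 3 (zero, suc zero, suc (suc zero)).
Peg : Set
Peg = Fin 3

-- The third peg k = 6 - i - j (only meaningful when i ≢ j).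
third : Peg → Peg → Peg
third zero (suc zero) = suc (suc zero)
third (suc zero) zero = suc (suc zero)
third zero (suc (suc zero)) = suc zero
third (suc (suc zero)) zero = suc zero
third (suc zero) (suc (suc zero)) = zero
third (suc (suc zero)) (suc zero) = zero
third _ _ = zero

Weights : Set
Weights = Peg → Peg → ℚ

-- A state with n discs: position (peg) of every disc.
-- Disc d : Fin n; smaller index = smaller diameter.
State : ℕ → Set
State n = Vec Peg n

-- A move takes the topmost disc of peg a to peg b, written (a , b).
Move : Set
Move = Peg × Peg

LegalMove : {n : ℕ} → State n → Move → State n → Set
LegalMove {n} s (a , b) s' =
  a ≢ b × Σ (Fin n) λ d →
    lookup s d ≡ a ×
    (∀ (e : Fin n) → e < d → lookup s e ≢ a × lookup s e ≢ b) ×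
    s' ≡ s [ d ]≔ b

data Run {n : ℕ} : State n → List Move → State n → Set where
  done : ∀ {s} → Run s [] s
  step : ∀ {s s' s'' m ms} → LegalMove s m s' → Run s' ms s'' → Run s (m ∷ ms) s''

Solution : (n : ℕ) → Peg → Peg → List Move → Set
Solution n i j ms = Run (replicate n i) ms (replicate n j)

cost : Weights → List Move → ℚ
cost w [] = 0ℚ
cost w ((a , b) ∷ ms) = w a b + cost w ms

Optimal : Weights → (n : ℕ) → Peg → Peg → List Move → Set
Optimal w n i j ms =
  Solution n i j ms × (∀ ms' → Solution n i j ms' → cost w ms ≤ cost w ms')

IsOptimalCost : Weights → (n : ℕ) → Peg → Peg → ℚ → Set
IsOptimalCost w n i j c =
  (Σ (List Move) λ ms → Solution n i j ms × cost w ms ≡ c) ×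
  (∀ ms → Solution n i j ms → c ≤ cost w ms)

-- Algorithm WTHD(n,i,j), parameterised by the table C of optimal costs
-- (C n i j plays the role of C_n^{i,j}).  WTHD(0,i,j) is the empty sequence.
wthd : Weights → (ℕ → Peg → Peg → ℚ) → ℕ → Peg → Peg → List Move
wthd w C zero i j = []
wthd w C (suc zero) i j =
  if does (w i j ≤? (w i k + w k j))
  then (i , j) ∷ []
  else (i , k) ∷ (k , j) ∷ []
  where k = third i j
wthd w C (suc (suc m)) i j =
  if does ((C (suc m) i k + C (suc m) k j + w i j)
             ≤? (C (suc m) i j + C (suc m) i j + C (suc m) j i + w i k + w k j))
  then wthd w C (suc m) i k ++ ((i , j) ∷ wthd w C (suc m) k j)
  else wthd w C (suc m) i j ++ ((i , k) ∷ wthd w C (suc m) j i)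
         ++ ((k , j) ∷ wthd w C (suc m) i j)
  where k = third i j

{-# OPTIONS --safe #-}
module Submission where

-- Order move sequences lexicographically by (total cost, number of moves); by induction on n,
-- WTHD(n,i,j) is least in this order among all solutions, which gives both claims at once.
-- Track the largest disc along an arbitrary solution for n+1 discs: whenever it moves from a to b
-- the smaller discs sit on the third peg, and between its moves they perform n-disc transfers, each
-- costing at least the optimal one.  By the triangle inequality for optimal n-disc transfers and
-- nonnegativity of the weights, induction along the run shows that the solution costs at least one
-- of two candidates: move the largest disc directly, or twice via the third peg.  WTHD takes the
-- cheaper candidate (its test reads C, which by induction is the cost of WTHD itself), preferring
-- the direct one on a tie, and the direct candidate is never the longer one.

open import Defs
open import Data.Nat using (ℕ; _≤_)
open import Data.List using (List; length)
open import Data.Rational using (ℚ; 0ℚ) renaming (_≤_ to _≤ℚ_)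
open import Data.Product using (_×_)
open import Relation.Binary.PropositionalEquality using (_≢_)

open import Data.Bool using (true; false; if_then_else_)
open import Data.Empty using (⊥-elim)
open import Data.Fin using (Fin; zero; suc; fromℕ; inject₁; toℕ; _≟_)
import Data.Fin as F
import Data.Fin.Properties as Fₚ
open import Data.Fin.Relation.Unary.Top using (view; ‵fromℕ; ‵inject₁)
open import Data.List using ([]; _∷_; _++_)
import Data.List.Properties as Listₚ
open import Data.Nat using (zero; suc; z≤n; s≤s)
import Data.Nat as ℕ
import Data.Nat.Properties as ℕₚ
open import Data.Nat.Tactic.RingSolver using (solve-∀)
open import Data.Product using (_,_; proj₁; proj₂)
open import Data.Product.Relation.Binary.Lex.Strict using (×-Lex; ×-transitive)
open import Data.Rational using (_+_) renaming (_<_ to _<ℚ_)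
open import Data.Rational.Properties using (_≤?_)
import Data.Rational.Properties as ℚₚ
open import Data.Rational.Solver using (module +-*-Solver)
open import Data.Sum using (_⊎_; inj₁; inj₂; [_,_]′)
open import Data.Vec using (Vec; []; _∷_; _∷ʳ_; replicate; lookup; _[_]≔_)
open import Data.Vec.Properties using (lookup-replicate; ∷ʳ-injective)
open import Function using (_∘_)
open import Relation.Binary.Bundles using (Preorder)
open import Relation.Binary.Definitions using (tri<; tri≈; tri>)
open import Relation.Binary.PropositionalEquality
  using (_≡_; refl; sym; trans; cong; cong₂; subst; subst₂; ≢-sym; isEquivalence)
import Relation.Binary.Reasoning.Preorder as PreorderReasoning
open import Relation.Nullary using (Dec; yes; no; does)

third-unique : ∀ {a b x : Peg} → a ≢ b → x ≢ a → x ≢ b → x ≡ third a b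
third-unique {zero}           {zero}           a≢b _ _ = ⊥-elim (a≢b refl)
third-unique {suc zero}       {suc zero}       a≢b _ _ = ⊥-elim (a≢b refl)
third-unique {suc (suc zero)} {suc (suc zero)} a≢b _ _ = ⊥-elim (a≢b refl)
third-unique {zero}           {suc zero}       {zero}           _ x≢a _ = ⊥-elim (x≢a refl)
third-unique {zero}           {suc zero}       {suc zero}       _ _ x≢b = ⊥-elim (x≢b refl)
third-unique {zero}           {suc zero}       {suc (suc zero)} _ _ _   = refl
third-unique {zero}           {suc (suc zero)} {zero}           _ x≢a _ = ⊥-elim (x≢a refl)
third-unique {zero}           {suc (suc zero)} {suc zero}       _ _ _   = refl
third-unique {zero}           {suc (suc zero)} {suc (suc zero)} _ _ x≢b = ⊥-elim (x≢b refl)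
third-unique {suc zero}       {zero}           {zero}           _ _ x≢b = ⊥-elim (x≢b refl)
third-unique {suc zero}       {zero}           {suc zero}       _ x≢a _ = ⊥-elim (x≢a refl)
third-unique {suc zero}       {zero}           {suc (suc zero)} _ _ _   = refl
third-unique {suc zero}       {suc (suc zero)} {zero}           _ _ _   = refl
third-unique {suc zero}       {suc (suc zero)} {suc zero}       _ x≢a _ = ⊥-elim (x≢a refl)
third-unique {suc zero}       {suc (suc zero)} {suc (suc zero)} _ _ x≢b = ⊥-elim (x≢b refl)
third-unique {suc (suc zero)} {zero}           {zero}           _ _ x≢b = ⊥-elim (x≢b refl)
third-unique {suc (suc zero)} {zero}           {suc zero}       _ _ _   = refl
third-unique {suc (suc zero)} {zero}           {suc (suc zero)} _ x≢a _ = ⊥-elim (x≢a refl)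
third-unique {suc (suc zero)} {suc zero}       {zero}           _ _ _   = refl
third-unique {suc (suc zero)} {suc zero}       {suc zero}       _ _ x≢b = ⊥-elim (x≢b refl)
third-unique {suc (suc zero)} {suc zero}       {suc (suc zero)} _ x≢a _ = ⊥-elim (x≢a refl)

third-≢ˡ : ∀ {a b : Peg} → a ≢ b → third a b ≢ a
third-≢ˡ {zero}           {zero}           a≢b = ⊥-elim (a≢b refl)
third-≢ˡ {suc zero}       {suc zero}       a≢b = ⊥-elim (a≢b refl)
third-≢ˡ {suc (suc zero)} {suc (suc zero)} a≢b = ⊥-elim (a≢b refl)
third-≢ˡ {zero}           {suc zero}       _ ()
third-≢ˡ {zero}           {suc (suc zero)} _ ()
third-≢ˡ {suc zero}       {zero}           _ ()
third-≢ˡ {suc zero}       {suc (suc zero)} _ ()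
third-≢ˡ {suc (suc zero)} {zero}           _ ()
third-≢ˡ {suc (suc zero)} {suc zero}       _ ()

third-≢ʳ : ∀ {a b : Peg} → a ≢ b → third a b ≢ b
third-≢ʳ {zero}           {zero}           a≢b = ⊥-elim (a≢b refl)
third-≢ʳ {suc zero}       {suc zero}       a≢b = ⊥-elim (a≢b refl)
third-≢ʳ {suc (suc zero)} {suc (suc zero)} a≢b = ⊥-elim (a≢b refl)
third-≢ʳ {zero}           {suc zero}       _ ()
third-≢ʳ {zero}           {suc (suc zero)} _ ()
third-≢ʳ {suc zero}       {zero}           _ ()
third-≢ʳ {suc zero}       {suc (suc zero)} _ ()
third-≢ʳ {suc (suc zero)} {zero}           _ ()
third-≢ʳ {suc (suc zero)} {suc zero}       _ ()

third-comm : ∀ {a b : Peg} → a ≢ b → third b a ≡ third a b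
third-comm a≢b = third-unique a≢b (third-≢ʳ (≢-sym a≢b)) (third-≢ˡ (≢-sym a≢b))

inject₁-mono-< : ∀ {n} {i j : Fin n} → i F.< j → inject₁ i F.< inject₁ j
inject₁-mono-< {i = i} {j} = subst₂ ℕ._<_ (sym (Fₚ.toℕ-inject₁ i)) (sym (Fₚ.toℕ-inject₁ j))

inject₁-cancel-< : ∀ {n} {i j : Fin n} → inject₁ i F.< inject₁ j → i F.< j
inject₁-cancel-< {i = i} {j} = subst₂ ℕ._<_ (Fₚ.toℕ-inject₁ i) (Fₚ.toℕ-inject₁ j)

inject₁<fromℕ : ∀ {n} (i : Fin n) → inject₁ i F.< fromℕ n
inject₁<fromℕ {n} i = subst (toℕ (inject₁ i) ℕ.<_) (sym (Fₚ.toℕ-fromℕ n)) (Fₚ.inject₁ℕ< i)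

-- Disc fromℕ n is the largest, so a state of n+1 discs is t ∷ʳ p with p the peg of the largest disc.
module _ {A : Set} where

  lookup-∷ʳ-inject₁ : ∀ {n} (t : Vec A n) p i → lookup (t ∷ʳ p) (inject₁ i) ≡ lookup t i
  lookup-∷ʳ-inject₁ (x ∷ t) p zero    = refl
  lookup-∷ʳ-inject₁ (x ∷ t) p (suc i) = lookup-∷ʳ-inject₁ t p i

  lookup-∷ʳ-fromℕ : ∀ {n} (t : Vec A n) p → lookup (t ∷ʳ p) (fromℕ n) ≡ p
  lookup-∷ʳ-fromℕ []      p = refl
  lookup-∷ʳ-fromℕ (x ∷ t) p = lookup-∷ʳ-fromℕ t p

  []≔-∷ʳ-inject₁ : ∀ {n} (t : Vec A n) p i b → (t ∷ʳ p) [ inject₁ i ]≔ b ≡ (t [ i ]≔ b) ∷ʳ p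
  []≔-∷ʳ-inject₁ (x ∷ t) p zero    b = refl
  []≔-∷ʳ-inject₁ (x ∷ t) p (suc i) b = cong (x ∷_) ([]≔-∷ʳ-inject₁ t p i b)

  []≔-∷ʳ-fromℕ : ∀ {n} (t : Vec A n) p b → (t ∷ʳ p) [ fromℕ n ]≔ b ≡ t ∷ʳ b
  []≔-∷ʳ-fromℕ []      p b = refl
  []≔-∷ʳ-fromℕ (x ∷ t) p b = cong (x ∷_) ([]≔-∷ʳ-fromℕ t p b)

  replicate-∷ʳ : ∀ n (x : A) → replicate n x ∷ʳ x ≡ replicate (suc n) x
  replicate-∷ʳ zero    x = refl
  replicate-∷ʳ (suc n) x = cong (x ∷_) (replicate-∷ʳ n x)

  lookup-const⇒replicate : ∀ {n} (t : Vec A n) {x} → (∀ i → lookup t i ≡ x) → t ≡ replicate n x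
  lookup-const⇒replicate []      t≡x = refl
  lookup-const⇒replicate (y ∷ t) t≡x = cong₂ _∷_ (t≡x zero) (lookup-const⇒replicate t (t≡x ∘ suc))

run-++ : ∀ {n} {s t u : State n} {xs ys} → Run s xs t → Run t ys u → Run s (xs ++ ys) u
run-++ done       r′ = r′
run-++ (step l r) r′ = step l (run-++ r r′)

legal-∷ʳ : ∀ {n} {t t′ : State n} {m} p → LegalMove t m t′ → LegalMove (t ∷ʳ p) m (t′ ∷ʳ p)
legal-∷ʳ {t = t} {m = a , b} p (a≢b , i , i-on-a , i-on-top , refl) =
  a≢b , inject₁ i , trans (lookup-∷ʳ-inject₁ t p i) i-on-a , on-top , sym ([]≔-∷ʳ-inject₁ t p i b)
  where
  on-top : ∀ e → e F.< inject₁ i → lookup (t ∷ʳ p) e ≢ a × lookup (t ∷ʳ p) e ≢ b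
  on-top e e<i with view e
  ... | ‵fromℕ      = ⊥-elim (Fₚ.<-asym e<i (inject₁<fromℕ i))
  ... | ‵inject₁ e′ rewrite lookup-∷ʳ-inject₁ t p e′ = i-on-top e′ (inject₁-cancel-< e<i)

run-∷ʳ : ∀ {n} {t t′ : State n} {ms} p → Run t ms t′ → Run (t ∷ʳ p) ms (t′ ∷ʳ p)
run-∷ʳ p done       = done
run-∷ʳ p (step l r) = step (legal-∷ʳ p l) (run-∷ʳ p r)

legal-largest : ∀ {n a b z} → a ≢ b → z ≢ a → z ≢ b →
                LegalMove (replicate n z ∷ʳ a) (a , b) (replicate n z ∷ʳ b)
legal-largest {n} {a} {b} {z} a≢b z≢a z≢b =
  a≢b , fromℕ n , lookup-∷ʳ-fromℕ (replicate n z) a , on-top , sym ([]≔-∷ʳ-fromℕ _ a b)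
  where
  on-top : ∀ e → e F.< fromℕ n → lookup (replicate n z ∷ʳ a) e ≢ a × lookup (replicate n z ∷ʳ a) e ≢ b
  on-top e e<n with view e
  ... | ‵fromℕ     = ⊥-elim (Fₚ.<-irrefl refl e<n)
  ... | ‵inject₁ i rewrite lookup-∷ʳ-inject₁ (replicate n z) a i | lookup-replicate i z = z≢a , z≢b

data LegalMove-∷ʳ {n} (t : State n) (p : Peg) : Move → State (suc n) → Set where
  smaller : ∀ {m t′} → LegalMove t m t′ → LegalMove-∷ʳ t p m (t′ ∷ʳ p)
  largest : ∀ {b} → p ≢ b → t ≡ replicate n (third p b) → LegalMove-∷ʳ t p (p , b) (t ∷ʳ b)

legalMove-∷ʳ : ∀ {n} {t : State n} {p m s′} → LegalMove (t ∷ʳ p) m s′ → LegalMove-∷ʳ t p m s′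
legalMove-∷ʳ {t = t} {p} {a , b} (a≢b , d , d-on-a , d-on-top , refl) with view d
... | ‵inject₁ i rewrite []≔-∷ʳ-inject₁ t p i b =
  smaller (a≢b , i , trans (sym (lookup-∷ʳ-inject₁ t p i)) d-on-a , on-top , refl)
  where
  on-top : ∀ e → e F.< i → lookup t e ≢ a × lookup t e ≢ b
  on-top e e<i rewrite sym (lookup-∷ʳ-inject₁ t p e) = d-on-top (inject₁ e) (inject₁-mono-< e<i)
... | ‵fromℕ with trans (sym (lookup-∷ʳ-fromℕ t p)) d-on-a
...   | refl rewrite []≔-∷ʳ-fromℕ t p b = largest a≢b (lookup-const⇒replicate t on-third)
  where
  on-third : ∀ i → lookup t i ≡ third p b
  on-third i with d-on-top (inject₁ i) (inject₁<fromℕ i)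
  ... | ≢p , ≢b rewrite lookup-∷ʳ-inject₁ t p i = third-unique a≢b ≢p ≢b

direct viaThird : (Peg → Peg → List Move) → Peg → Peg → List Move
direct   T i j = T i k ++ (i , j) ∷ T k j                   where k = third i j
viaThird T i j = T i j ++ (i , k) ∷ T j i ++ (k , j) ∷ T i j where k = third i j

∷ʳ-solution : ∀ {n i j ms} → Run (replicate n i ∷ʳ i) ms (replicate n j ∷ʳ j) → Solution (suc n) i j ms
∷ʳ-solution {n} {i} {j} {ms} = subst₂ (λ s s′ → Run s ms s′) (replicate-∷ʳ n i) (replicate-∷ʳ n j)

module _ {n} {T : Peg → Peg → List Move} (T-solves : ∀ {a b} → a ≢ b → Solution n a b (T a b)) where

  direct-solution : ∀ {i j} → i ≢ j → Solution (suc n) i j (direct T i j)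
  direct-solution {i} {j} i≢j = ∷ʳ-solution
    (run-++ (run-∷ʳ i (T-solves (≢-sym k≢i)))
            (step (legal-largest i≢j k≢i k≢j) (run-∷ʳ j (T-solves k≢j))))
    where
    k≢i = third-≢ˡ i≢j
    k≢j = third-≢ʳ i≢j

  viaThird-solution : ∀ {i j} → i ≢ j → Solution (suc n) i j (viaThird T i j)
  viaThird-solution {i} {j} i≢j = ∷ʳ-solution
    (run-++ (run-∷ʳ i (T-solves i≢j))
      (step (legal-largest (≢-sym k≢i) (≢-sym i≢j) (≢-sym k≢j))
        (run-++ (run-∷ʳ k (T-solves (≢-sym i≢j)))
          (step (legal-largest k≢j (≢-sym k≢i) i≢j) (run-∷ʳ j (T-solves i≢j))))))
    where
    k = third i j
    k≢i = third-≢ˡ i≢j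
    k≢j = third-≢ʳ i≢j

module _ {T T′ : Peg → Peg → List Move} (T≡T′ : ∀ {a b} → a ≢ b → T a b ≡ T′ a b)
         {i j : Peg} (i≢j : i ≢ j) where

  direct-cong : direct T i j ≡ direct T′ i j
  direct-cong = cong₂ (λ A B → A ++ (i , j) ∷ B) (T≡T′ (≢-sym (third-≢ˡ i≢j))) (T≡T′ (third-≢ʳ i≢j))

  viaThird-cong : viaThird T i j ≡ viaThird T′ i j
  viaThird-cong =
    cong₂ (λ A B → A ++ (i , third i j) ∷ B ++ (third i j , j) ∷ A) (T≡T′ i≢j) (T≡T′ (≢-sym i≢j))

length-direct : ∀ T i j →
  length (direct T i j) ≡ length (T i (third i j)) ℕ.+ suc (length (T (third i j) j))
length-direct T i j = Listₚ.length-++ (T i (third i j))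

length-viaThird : ∀ T i j →
  length (viaThird T i j) ≡ length (T i j) ℕ.+ suc (length (T j i) ℕ.+ suc (length (T i j)))
length-viaThird T i j =
  trans (Listₚ.length-++ (T i j)) (cong (λ l → length (T i j) ℕ.+ suc l) (Listₚ.length-++ (T j i)))

Lex : Set
Lex = ℚ × ℕ

infix  4 _≤ₗ_
infixr 6 _+ₗ_

_≤ₗ_ : Lex → Lex → Set
_≤ₗ_ = ×-Lex _≡_ _<ℚ_ _≤_

0ₗ : Lex
0ₗ = 0ℚ , 0

_+ₗ_ : Lex → Lex → Lex
(c , l) +ₗ (c′ , l′) = c + c′ , l ℕ.+ l′

≤ₗ-reflexive : ∀ {x y} → x ≡ y → x ≤ₗ y
≤ₗ-reflexive refl = inj₂ (refl , ℕₚ.≤-refl)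

≤ₗ-refl : ∀ {x} → x ≤ₗ x
≤ₗ-refl = ≤ₗ-reflexive refl

≤ₗ-trans : ∀ {x y z} → x ≤ₗ y → y ≤ₗ z → x ≤ₗ z
≤ₗ-trans = ×-transitive {_<₂_ = _≤_} isEquivalence ℚₚ.<-resp-≡ ℚₚ.<-trans ℕₚ.≤-trans

≤ₗ-preorder : Preorder _ _ _
≤ₗ-preorder = record
  { isPreorder = record { isEquivalence = isEquivalence ; reflexive = ≤ₗ-reflexive ; trans = ≤ₗ-trans } }

module ≤ₗ-Reasoning = PreorderReasoning ≤ₗ-preorder

≤×≤⇒≤ₗ : ∀ {c c′ l l′} → c ≤ℚ c′ → l ≤ l′ → (c , l) ≤ₗ (c′ , l′)
≤×≤⇒≤ₗ {c} {c′} c≤c′ l≤l′ with ℚₚ.<-cmp c c′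
... | tri< c<c′ _ _ = inj₁ c<c′
... | tri≈ _ c≡c′ _ = inj₂ (c≡c′ , l≤l′)
... | tri> _ _ c>c′ = ⊥-elim (ℚₚ.<-irrefl refl (ℚₚ.<-≤-trans c>c′ c≤c′))

≤ₗ⇒proj₁≤ : ∀ {x y} → x ≤ₗ y → proj₁ x ≤ℚ proj₁ y
≤ₗ⇒proj₁≤ (inj₁ x<y)       = ℚₚ.<⇒≤ x<y
≤ₗ⇒proj₁≤ (inj₂ (x≡y , _)) = ℚₚ.≤-reflexive x≡y

≤ₗ∧proj₁≥⇒proj₂≤ : ∀ {x y} → x ≤ₗ y → proj₁ y ≤ℚ proj₁ x → proj₂ x ≤ proj₂ y
≤ₗ∧proj₁≥⇒proj₂≤ (inj₁ x<y)       y≤x = ⊥-elim (ℚₚ.<-irrefl refl (ℚₚ.<-≤-trans x<y y≤x))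
≤ₗ∧proj₁≥⇒proj₂≤ (inj₂ (_ , x≤y)) _   = x≤y

+ₗ-mono-≤ₗ : ∀ {x x′ y y′} → x ≤ₗ x′ → y ≤ₗ y′ → x +ₗ y ≤ₗ x′ +ₗ y′
+ₗ-mono-≤ₗ (inj₁ x<x′)        (inj₁ y<y′)        = inj₁ (ℚₚ.+-mono-< x<x′ y<y′)
+ₗ-mono-≤ₗ (inj₁ x<x′)        (inj₂ (y≡y′ , _))  = inj₁ (ℚₚ.+-mono-<-≤ x<x′ (ℚₚ.≤-reflexive y≡y′))
+ₗ-mono-≤ₗ (inj₂ (x≡x′ , _))  (inj₁ y<y′)        = inj₁ (ℚₚ.+-mono-≤-< (ℚₚ.≤-reflexive x≡x′) y<y′)
+ₗ-mono-≤ₗ (inj₂ (x≡x′ , l≤)) (inj₂ (y≡y′ , l′≤)) = inj₂ (cong₂ _+_ x≡x′ y≡y′ , ℕₚ.+-mono-≤ l≤ l′≤)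

+ₗ-monoʳ-≤ₗ : ∀ x {y y′} → y ≤ₗ y′ → x +ₗ y ≤ₗ x +ₗ y′
+ₗ-monoʳ-≤ₗ x = +ₗ-mono-≤ₗ (≤ₗ-refl {x})

+ₗ-assoc : ∀ x y z → (x +ₗ y) +ₗ z ≡ x +ₗ y +ₗ z
+ₗ-assoc (a , l) (b , m) (c , o) = cong₂ _,_ (ℚₚ.+-assoc a b c) (ℕₚ.+-assoc l m o)

x≤ₗy+ₗx : ∀ {x y} → 0ₗ ≤ₗ y → x ≤ₗ y +ₗ x
x≤ₗy+ₗx {x} 0≤y = ≤ₗ-trans (≤ₗ-reflexive (cong (_, proj₂ x) (sym (ℚₚ.+-identityˡ (proj₁ x)))))
                           (+ₗ-mono-≤ₗ 0≤y (≤ₗ-refl {x}))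

module Lexicographic (w : Weights) where

  W : Peg → Peg → Lex
  W a b = w a b , 1

  lc : List Move → Lex
  lc ms = cost w ms , length ms

  cost-++ : ∀ xs ys → cost w (xs ++ ys) ≡ cost w xs + cost w ys
  cost-++ []             ys = sym (ℚₚ.+-identityˡ (cost w ys))
  cost-++ ((a , b) ∷ xs) ys =
    trans (cong (w a b +_) (cost-++ xs ys)) (sym (ℚₚ.+-assoc (w a b) (cost w xs) (cost w ys)))

  lc-++ : ∀ xs ys → lc (xs ++ ys) ≡ lc xs +ₗ lc ys
  lc-++ xs ys = cong₂ _,_ (cost-++ xs ys) (Listₚ.length-++ xs)

  cost-direct : ∀ T i j →
    cost w (direct T i j) ≡ cost w (T i (third i j)) + cost w (T (third i j) j) + w i j
  cost-direct T i j =
    trans (cost-++ (T i k) ((i , j) ∷ T k j)) (rearrange (cost w (T i k)) (w i j) (cost w (T k j)))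
    where
    open +-*-Solver
    k = third i j
    rearrange : ∀ a u b → a + (u + b) ≡ a + b + u
    rearrange = solve 3 (λ a u b → a :+ (u :+ b) := a :+ b :+ u) refl

  cost-viaThird : ∀ T i j → cost w (viaThird T i j) ≡
    cost w (T i j) + cost w (T i j) + cost w (T j i) + w i (third i j) + w (third i j) j
  cost-viaThird T i j =
    trans (cost-++ (T i j) ((i , k) ∷ T j i ++ (k , j) ∷ T i j))
      (trans (cong (λ c → cost w (T i j) + (w i k + c)) (cost-++ (T j i) ((k , j) ∷ T i j)))
             (rearrange (cost w (T i j)) (cost w (T j i)) (w i k) (w k j)))
    where
    open +-*-Solver
    k = third i j
    rearrange : ∀ a b u v → a + (u + (b + (v + a))) ≡ a + a + b + u + v
    rearrange = solve 4 (λ a b u v → a :+ (u :+ (b :+ (v :+ a))) := a :+ a :+ b :+ u :+ v) refl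

  cheaper : List Move → List Move → List Move
  cheaper A B = if does (cost w A ≤? cost w B) then A else B

  cheaper-≤ₗ : ∀ A B {X} → length A ≤ length B → lc A ≤ₗ X ⊎ lc B ≤ₗ X → lc (cheaper A B) ≤ₗ X
  cheaper-≤ₗ A B {X} |A|≤|B| = by-cases (cost w A ≤? cost w B)
    where
    by-cases : (A≤?B : Dec (cost w A ≤ℚ cost w B)) → lc A ≤ₗ X ⊎ lc B ≤ₗ X →
               lc (if does A≤?B then A else B) ≤ₗ X
    by-cases (yes A≤B) (inj₁ A≤X) = A≤X
    by-cases (yes A≤B) (inj₂ B≤X) = ≤ₗ-trans (≤×≤⇒≤ₗ A≤B |A|≤|B|) B≤X
    by-cases (no  A≰B) (inj₁ A≤X) = ≤ₗ-trans (inj₁ (ℚₚ.≰⇒> A≰B)) A≤X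
    by-cases (no  A≰B) (inj₂ B≤X) = B≤X

  LexOptimal : ℕ → Peg → Peg → List Move → Set
  LexOptimal n i j ms = Solution n i j ms × (∀ ms′ → Solution n i j ms′ → lc ms ≤ₗ lc ms′)

  lexOptimal⇒optimal : ∀ {n i j ms} → LexOptimal n i j ms →
    Optimal w n i j ms × (∀ ms′ → Optimal w n i j ms′ → length ms ≤ length ms′)
  lexOptimal⇒optimal (sol , minimal) =
    (sol , λ ms′ sol′ → ≤ₗ⇒proj₁≤ (minimal ms′ sol′)) ,
    λ ms′ (sol′ , cheapest) → ≤ₗ∧proj₁≥⇒proj₂≤ (minimal ms′ sol′) (cheapest _ sol)

module LowerBound (w : Weights) (w≥0 : ∀ a b → a ≢ b → 0ℚ ≤ℚ w a b) where

  open Lexicographic w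

  W-nonneg : ∀ {a b} → a ≢ b → 0ₗ ≤ₗ W a b
  W-nonneg {a} {b} a≢b = ≤×≤⇒≤ₗ (w≥0 a b a≢b) z≤n

  lc-nonneg : ∀ {n} {s s′ : State n} {ms} → Run s ms s′ → 0ₗ ≤ₗ lc ms
  lc-nonneg done               = ≤ₗ-refl
  lc-nonneg (step (a≢b , _) r) = +ₗ-mono-≤ₗ (W-nonneg a≢b) (lc-nonneg r)

  module _ {n} {T : Peg → Peg → List Move} (T-opt : ∀ a b → LexOptimal n a b (T a b)) where

    V : Peg → Peg → Lex
    V a b = lc (T a b)

    V-nonneg : ∀ a b → 0ₗ ≤ₗ V a b
    V-nonneg a b = lc-nonneg (proj₁ (T-opt a b))

    V-minimal : ∀ {a b ms} → Run (replicate n a) ms (replicate n b) → V a b ≤ₗ lc ms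
    V-minimal {a} {b} {ms} = proj₂ (T-opt a b) ms

    V-triangle : ∀ a b c → V a c ≤ₗ V a b +ₗ V b c
    V-triangle a b c = ≤ₗ-trans (V-minimal (run-++ (proj₁ (T-opt a b)) (proj₁ (T-opt b c))))
                                (≤ₗ-reflexive (lc-++ (T a b) (T b c)))

    directCost viaThirdCost : Peg → Peg → Peg → Peg → Lex
    directCost   x p y q = V x r +ₗ W p q +ₗ V r y                     where r = third p q
    viaThirdCost x p y q = V x q +ₗ W p r +ₗ V q p +ₗ W r q +ₗ V p y where r = third p q

    -- X bounds the cost of one of the candidate strategies that take the smaller discs from x and
    -- the largest disc from p to the smaller discs on y and the largest disc on q.
    data CandidateBelow (X : Lex) (x p y q : Peg) : Set where
      ≤stay     : p ≡ q → V x y ≤ₗ X → CandidateBelow X x p y q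
      ≤direct   : p ≢ q → directCost x p y q ≤ₗ X → CandidateBelow X x p y q
      ≤viaThird : p ≢ q → viaThirdCost x p y q ≤ₗ X → CandidateBelow X x p y q

    V≤directCost : ∀ {x p y q} → p ≢ q → V x y ≤ₗ directCost x p y q
    V≤directCost {x} {p} {y} {q} p≢q = begin
      V x y                        ≲⟨ V-triangle x r y ⟩
      V x r +ₗ V r y               ≲⟨ +ₗ-monoʳ-≤ₗ (V x r) (x≤ₗy+ₗx (W-nonneg p≢q)) ⟩
      V x r +ₗ W p q +ₗ V r y      ∎
      where
      open ≤ₗ-Reasoning
      r = third p q

    V≤viaThirdCost : ∀ {x p y q} → p ≢ q → V x y ≤ₗ viaThirdCost x p y q
    V≤viaThirdCost {x} {p} {y} {q} p≢q = begin
      V x y                                          ≲⟨ V-triangle x q y ⟩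
      V x q +ₗ V q y                                 ≲⟨ +ₗ-monoʳ-≤ₗ (V x q) (V-triangle q p y) ⟩
      V x q +ₗ V q p +ₗ V p y                        ≲⟨ +ₗ-monoʳ-≤ₗ (V x q) (x≤ₗy+ₗx (W-nonneg p≢r)) ⟩
      V x q +ₗ W p r +ₗ V q p +ₗ V p y               ≲⟨ +ₗ-monoʳ-≤ₗ (V x q) (+ₗ-monoʳ-≤ₗ (W p r)
                                                          (+ₗ-monoʳ-≤ₗ (V q p) (x≤ₗy+ₗx (W-nonneg r≢q)))) ⟩
      V x q +ₗ W p r +ₗ V q p +ₗ W r q +ₗ V p y      ∎
      where
      open ≤ₗ-Reasoning
      r = third p q
      p≢r = ≢-sym (third-≢ˡ p≢q)
      r≢q = third-≢ʳ p≢q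

    CandidateBelow⇒V≤ : ∀ {X x p y q} → CandidateBelow X x p y q → V x y ≤ₗ X
    CandidateBelow⇒V≤ (≤stay _ V≤X)         = V≤X
    CandidateBelow⇒V≤ (≤direct p≢q D≤X)     = ≤ₗ-trans (V≤directCost p≢q) D≤X
    CandidateBelow⇒V≤ (≤viaThird p≢q VT≤X)  = ≤ₗ-trans (V≤viaThirdCost p≢q) VT≤X

    via-after-direct : ∀ {X₀ X₁ x a b y q} → a ≢ b → a ≢ q → b ≢ q →
      V x (third a b) ≤ₗ X₀ → directCost (third a b) b y q ≤ₗ X₁ →
      viaThirdCost x a y q ≤ₗ X₀ +ₗ W a b +ₗ X₁
    via-after-direct {X₀} {X₁} {x} {a} {b} {y} {q} a≢b a≢q b≢q V≤X₀ D≤X₁ =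
      subst (λ r → V x q +ₗ W a r +ₗ V q a +ₗ W r q +ₗ V a y ≤ₗ X₀ +ₗ W a b +ₗ X₁) b≡third-a-q
        (+ₗ-mono-≤ₗ (subst (λ z → V x z ≤ₗ X₀) (sym q≡third-a-b) V≤X₀)
          (+ₗ-monoʳ-≤ₗ (W a b)
            (subst₂ (λ z r → V z r +ₗ W b q +ₗ V r y ≤ₗ X₁) (sym q≡third-a-b) (sym a≡third-b-q) D≤X₁)))
      where
      q≡third-a-b = third-unique a≢b (≢-sym a≢q) (≢-sym b≢q)
      a≡third-b-q = third-unique b≢q a≢b a≢q
      b≡third-a-q = third-unique a≢q (≢-sym a≢b) b≢q

    direct-after-via : ∀ {X₀ X₁ x a b y q} → a ≢ b → a ≢ q → b ≢ q →
      V x (third a b) ≤ₗ X₀ → viaThirdCost (third a b) b y q ≤ₗ X₁ →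
      directCost x a y q ≤ₗ X₀ +ₗ W a b +ₗ X₁
    direct-after-via {X₀} {X₁} {x} {a} {b} {y} {q} a≢b a≢q b≢q V≤X₀ VT≤X₁ =
      subst (λ r → V x r +ₗ W a q +ₗ V r y ≤ₗ X₀ +ₗ W a b +ₗ X₁) b≡third-a-q (begin
        V x b +ₗ R                 ≲⟨ +ₗ-mono-≤ₗ (V-triangle x q b) (≤ₗ-refl {R}) ⟩
        (V x q +ₗ V q b) +ₗ R      ≡⟨ +ₗ-assoc (V x q) (V q b) R ⟩
        V x q +ₗ V q b +ₗ R        ≲⟨ +ₗ-mono-≤ₗ (subst (λ z → V x z ≤ₗ X₀) (sym q≡third-a-b) V≤X₀) rest ⟩
        X₀ +ₗ W a b +ₗ X₁          ∎)
      where
      open ≤ₗ-Reasoning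
      q≡third-a-b = third-unique a≢b (≢-sym a≢q) (≢-sym b≢q)
      a≡third-b-q = third-unique b≢q a≢b a≢q
      b≡third-a-q = third-unique a≢q (≢-sym a≢b) b≢q
      R = W a q +ₗ V b y
      rest : V q b +ₗ R ≤ₗ W a b +ₗ X₁
      rest = begin
        V q b +ₗ R                          ≲⟨ x≤ₗy+ₗx (W-nonneg (≢-sym a≢b)) ⟩
        W b a +ₗ V q b +ₗ R                 ≲⟨ x≤ₗy+ₗx (V-nonneg q q) ⟩
        V q q +ₗ W b a +ₗ V q b +ₗ R        ≲⟨ subst₂ (λ z r → V z q +ₗ W b r +ₗ V q b +ₗ W r q +ₗ V b y ≤ₗ X₁)
                                                        (sym q≡third-a-b) (sym a≡third-b-q) VT≤X₁ ⟩
        X₁                                  ≲⟨ x≤ₗy+ₗx (W-nonneg a≢b) ⟩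
        W a b +ₗ X₁                         ∎

    candidate-after-largest : ∀ {X₀ X₁ x a b y q} → a ≢ b → V x (third a b) ≤ₗ X₀ →
      CandidateBelow X₁ (third a b) b y q → CandidateBelow (X₀ +ₗ W a b +ₗ X₁) x a y q
    candidate-after-largest {X₀} {X₁} {x} {a} {b} {y} {q} a≢b V≤X₀ c with a ≟ q
    ... | yes refl = ≤stay refl (begin
      V x y                                ≲⟨ V-triangle x (third a b) y ⟩
      V x (third a b) +ₗ V (third a b) y   ≲⟨ +ₗ-mono-≤ₗ V≤X₀ (≤ₗ-trans (CandidateBelow⇒V≤ c)
                                                                        (x≤ₗy+ₗx (W-nonneg a≢b))) ⟩
      X₀ +ₗ W a b +ₗ X₁                    ∎)
      where open ≤ₗ-Reasoning
    ... | no a≢q with c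
    ...   | ≤stay refl V≤X₁     = ≤direct a≢b (+ₗ-mono-≤ₗ V≤X₀ (+ₗ-monoʳ-≤ₗ (W a b) V≤X₁))
    ...   | ≤direct b≢q D≤X₁    = ≤viaThird a≢q (via-after-direct a≢b a≢q b≢q V≤X₀ D≤X₁)
    ...   | ≤viaThird b≢q VT≤X₁ = ≤direct a≢q (direct-after-via a≢b a≢q b≢q V≤X₀ VT≤X₁)

    -- Intermediate states are arbitrary, so the smaller discs are reached from a stack on x by a
    -- prefix P; its cost is charged as an n-disc transfer from x once the largest disc moves.
    run-bound : ∀ {t p ms s′ x y q P} → Run (t ∷ʳ p) ms s′ → s′ ≡ replicate n y ∷ʳ q →
                Run (replicate n x) P t → CandidateBelow (lc (P ++ ms)) x p y q
    run-bound {t} {P = P} done s′≡ P-run with ∷ʳ-injective t (replicate n _) s′≡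
    ... | refl , refl =
      ≤stay refl (≤ₗ-trans (V-minimal P-run) (≤ₗ-reflexive (cong lc (sym (Listₚ.++-identityʳ P)))))
    run-bound {p = p} {P = P} (step {m = m} {ms = ms} l r) s′≡ P-run with legalMove-∷ʳ l
    ... | smaller l′ =
      subst (λ L → CandidateBelow (lc L) _ p _ _) (Listₚ.++-assoc P (m ∷ []) ms)
            (run-bound r s′≡ (run-++ P-run (step l′ done)))
    ... | largest {b} p≢b refl =
      subst (λ X → CandidateBelow X _ p _ _) (sym (lc-++ P ((p , b) ∷ ms)))
            (candidate-after-largest p≢b (V-minimal P-run) (run-bound r s′≡ done))

    lc-direct : ∀ i j → lc (direct T i j) ≡ directCost i i j j
    lc-direct i j = lc-++ (T i (third i j)) ((i , j) ∷ T (third i j) j)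

    lc-viaThird : ∀ i j → lc (viaThird T i j) ≡ viaThirdCost i i j j
    lc-viaThird i j = trans (lc-++ (T i j) ((i , k) ∷ T j i ++ (k , j) ∷ T i j))
                            (cong (λ X → V i j +ₗ W i k +ₗ X) (lc-++ (T j i) ((k , j) ∷ T i j)))
      where k = third i j

    solution-bound : ∀ {i j ms} → i ≢ j → Solution (suc n) i j ms →
                     lc (direct T i j) ≤ₗ lc ms ⊎ lc (viaThird T i j) ≤ₗ lc ms
    solution-bound {i} {j} {ms} i≢j sol
      with run-bound (subst (λ s → Run s ms _) (sym (replicate-∷ʳ n i)) sol) (sym (replicate-∷ʳ n j)) done
    ... | ≤stay i≡j _     = ⊥-elim (i≢j i≡j)
    ... | ≤direct _ D≤    = inj₁ (≤ₗ-trans (≤ₗ-reflexive (lc-direct i j)) D≤)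
    ... | ≤viaThird _ VT≤ = inj₂ (≤ₗ-trans (≤ₗ-reflexive (lc-viaThird i j)) VT≤)

if-either : ∀ {A : Set} b (x y : A) → (if b then x else y) ≡ x ⊎ (if b then x else y) ≡ y
if-either true  x y = inj₁ refl
if-either false x y = inj₂ refl

if-≤?-cong : ∀ {A : Set} {x x′ y y′} (B₁ B₂ : A) → x ≡ x′ → y ≡ y′ →
             (if does (x ≤? y) then B₁ else B₂) ≡ (if does (x′ ≤? y′) then B₁ else B₂)
if-≤?-cong _ _ refl refl = refl

module WTHD (w : Weights) (C : ℕ → Peg → Peg → ℚ) where
  open Lexicographic w

  wthd-shape : ∀ n a b → wthd w C (suc n) a b ≡ direct (wthd w C n) a b
                       ⊎ wthd w C (suc n) a b ≡ viaThird (wthd w C n) a b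
  wthd-shape zero    a b = if-either _ _ _
  wthd-shape (suc n) a b = if-either _ _ _

  length-wthd-suc : ∀ n a b → length (direct (wthd w C n) a b) ≤ length (viaThird (wthd w C n) a b) →
    length (direct (wthd w C n) a b) ≤ length (wthd w C (suc n) a b) ×
    length (wthd w C (suc n) a b) ≤ length (viaThird (wthd w C n) a b)
  length-wthd-suc n a b D≤VT = between (wthd-shape n a b)
    where
    Between : List Move → Set
    Between L = length (direct (wthd w C n) a b) ≤ length L × length L ≤ length (viaThird (wthd w C n) a b)
    between : wthd w C (suc n) a b ≡ direct (wthd w C n) a b
            ⊎ wthd w C (suc n) a b ≡ viaThird (wthd w C n) a b → Between (wthd w C (suc n) a b)
    between (inj₁ eq) = subst Between (sym eq) (ℕₚ.≤-refl , D≤VT)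
    between (inj₂ eq) = subst Between (sym eq) (D≤VT , ℕₚ.≤-refl)

  direct-shorter : ∀ n {i j} → i ≢ j →
    length (direct (wthd w C n) i j) ≤ length (viaThird (wthd w C n) i j)
  direct-shorter zero    _ = s≤s z≤n
  direct-shorter (suc n) {i} {j} i≢j = begin
    length (direct T′ i j)
      ≡⟨ length-direct T′ i j ⟩
    ℓ′ i k ℕ.+ suc (ℓ′ k j)
      ≤⟨ ℕₚ.+-mono-≤ (above (≢-sym k≢i)) (s≤s (above k≢j)) ⟩
    length (viaThird T i k) ℕ.+ suc (length (viaThird T k j))
      ≡⟨ candidate-lengths ⟩
    length (direct T i j) ℕ.+ suc (length (direct T j i) ℕ.+ suc (length (direct T i j)))
      ≤⟨ ℕₚ.+-mono-≤ (below i≢j) (s≤s (ℕₚ.+-mono-≤ (below (≢-sym i≢j)) (s≤s (below i≢j)))) ⟩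
    ℓ′ i j ℕ.+ suc (ℓ′ j i ℕ.+ suc (ℓ′ i j))
      ≡⟨ length-viaThird T′ i j ⟨
    length (viaThird T′ i j)
      ∎
    where
    open ℕₚ.≤-Reasoning
    T  = wthd w C n
    T′ = wthd w C (suc n)
    ℓ ℓ′ : Peg → Peg → ℕ
    ℓ  a b = length (T a b)
    ℓ′ a b = length (T′ a b)
    k = third i j
    k≢i = third-≢ˡ i≢j
    k≢j = third-≢ʳ i≢j
    below : ∀ {a b} → a ≢ b → length (direct T a b) ≤ ℓ′ a b
    below {a} {b} a≢b = proj₁ (length-wthd-suc n a b (direct-shorter n a≢b))
    above : ∀ {a b} → a ≢ b → ℓ′ a b ≤ length (viaThird T a b)
    above {a} {b} a≢b = proj₂ (length-wthd-suc n a b (direct-shorter n a≢b))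
    length-direct-ji : length (direct T j i) ≡ ℓ j k ℕ.+ suc (ℓ k i)
    length-direct-ji = trans (length-direct T j i) (cong (λ r → ℓ j r ℕ.+ suc (ℓ r i)) (third-comm i≢j))
    rearrange : ∀ a b c d → (a ℕ.+ suc (b ℕ.+ suc a)) ℕ.+ suc (c ℕ.+ suc (d ℕ.+ suc c))
                          ≡ (a ℕ.+ suc c) ℕ.+ suc ((d ℕ.+ suc b) ℕ.+ suc (a ℕ.+ suc c))
    rearrange = solve-∀
    candidate-lengths : length (viaThird T i k) ℕ.+ suc (length (viaThird T k j))
                      ≡ length (direct T i j) ℕ.+ suc (length (direct T j i) ℕ.+ suc (length (direct T i j)))
    candidate-lengths = begin-equality
      length (viaThird T i k) ℕ.+ suc (length (viaThird T k j))
        ≡⟨ cong₂ (λ A B → A ℕ.+ suc B) (length-viaThird T i k) (length-viaThird T k j) ⟩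
      (ℓ i k ℕ.+ suc (ℓ k i ℕ.+ suc (ℓ i k))) ℕ.+ suc (ℓ k j ℕ.+ suc (ℓ j k ℕ.+ suc (ℓ k j)))
        ≡⟨ rearrange (ℓ i k) (ℓ k i) (ℓ k j) (ℓ j k) ⟩
      (ℓ i k ℕ.+ suc (ℓ k j)) ℕ.+ suc ((ℓ j k ℕ.+ suc (ℓ k i)) ℕ.+ suc (ℓ i k ℕ.+ suc (ℓ k j)))
        ≡⟨ cong₂ (λ A B → A ℕ.+ suc (B ℕ.+ suc A)) (length-direct T i j) length-direct-ji ⟨
      length (direct T i j) ℕ.+ suc (length (direct T j i) ℕ.+ suc (length (direct T i j)))   ∎

  wthd-suc : ∀ n {a b} → (∀ {a b} → a ≢ b → C n a b ≡ cost w (wthd w C n a b)) → a ≢ b →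
             wthd w C (suc n) a b ≡ cheaper (direct (wthd w C n) a b) (viaThird (wthd w C n) a b)
  -- WTHD(1,a,b) compares the weights directly and does not consult C.
  wthd-suc zero {a} {b} _ _ =
    if-≤?-cong _ _ (sym (ℚₚ.+-identityʳ (w a b))) (cong (w a k +_) (sym (ℚₚ.+-identityʳ (w k b))))
    where k = third a b
  wthd-suc (suc n) {a} {b} C-correct a≢b =
    if-≤?-cong _ _
      (trans (cong₂ (λ c c′ → c + c′ + w a b) (C-correct (≢-sym k≢a)) (C-correct k≢b)) (sym (cost-direct T a b)))
      (trans (cong₂ (λ c c′ → c + c + c′ + w a k + w k b) (C-correct a≢b) (C-correct (≢-sym a≢b)))
             (sym (cost-viaThird T a b)))
    where
    T = wthd w C (suc n)
    k = third a b
    k≢a = third-≢ˡ a≢b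
    k≢b = third-≢ʳ a≢b

  -- WTHD(n,a,a) is meaningless; the optimal transfer from a peg to itself is empty.
  transfer : ℕ → Peg → Peg → List Move
  transfer n a b with a ≟ b
  ... | yes _ = []
  ... | no  _ = wthd w C n a b

  transfer-≢ : ∀ n {a b} → a ≢ b → transfer n a b ≡ wthd w C n a b
  transfer-≢ n {a} {b} a≢b with a ≟ b
  ... | yes a≡b = ⊥-elim (a≢b a≡b)
  ... | no  _   = refl

  module _ (w≥0 : ∀ a b → a ≢ b → 0ℚ ≤ℚ w a b)
           (C-opt : ∀ n i j → i ≢ j → IsOptimalCost w n i j (C n i j)) where

    open LowerBound w w≥0

    transfer-lexOptimal : ∀ {n} → (∀ {a b} → a ≢ b → LexOptimal n a b (wthd w C n a b)) →
                          ∀ a b → LexOptimal n a b (transfer n a b)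
    transfer-lexOptimal opt a b with a ≟ b
    ... | yes refl = done , λ _ sol → lc-nonneg sol
    ... | no  a≢b  = opt a≢b

    C≡cost : ∀ {n} → (∀ {a b} → a ≢ b → LexOptimal n a b (wthd w C n a b)) →
             ∀ {a b} → a ≢ b → C n a b ≡ cost w (wthd w C n a b)
    C≡cost {n} opt {a} {b} a≢b with C-opt n a b a≢b | opt a≢b
    ... | (ms , sol , cost≡C) , C≤ | wthd-sol , wthd-min =
      ℚₚ.≤-antisym (C≤ _ wthd-sol)
                   (subst (cost w (wthd w C n a b) ≤ℚ_) cost≡C (≤ₗ⇒proj₁≤ (wthd-min ms sol)))

    wthd-lexOptimal : ∀ n {a b} → a ≢ b → LexOptimal n a b (wthd w C n a b)
    wthd-lexOptimal zero    _ = done , λ _ sol → lc-nonneg sol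
    wthd-lexOptimal (suc n) {a} {b} a≢b = solution , minimal
      where
      opt : ∀ {a b} → a ≢ b → LexOptimal n a b (wthd w C n a b)
      opt = wthd-lexOptimal n
      solves : ∀ {a b} → a ≢ b → Solution n a b (wthd w C n a b)
      solves a≢b = proj₁ (opt a≢b)
      solution : Solution (suc n) a b (wthd w C (suc n) a b)
      solution = [ (λ eq → subst (Solution (suc n) a b) (sym eq) (direct-solution solves a≢b))
                 , (λ eq → subst (Solution (suc n) a b) (sym eq) (viaThird-solution solves a≢b)) ]′
                 (wthd-shape n a b)
      minimal : ∀ ms → Solution (suc n) a b ms → lc (wthd w C (suc n) a b) ≤ₗ lc ms
      minimal ms sol =
        subst (λ L → lc L ≤ₗ lc ms) (sym (wthd-suc n (C≡cost opt) a≢b))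
              (cheaper-≤ₗ (direct T a b) (viaThird T a b) (direct-shorter n a≢b) candidates)
        where
        T = wthd w C n
        candidates : lc (direct T a b) ≤ₗ lc ms ⊎ lc (viaThird T a b) ≤ₗ lc ms
        candidates = subst₂ (λ A B → lc A ≤ₗ lc ms ⊎ lc B ≤ₗ lc ms)
                            (direct-cong (transfer-≢ n) a≢b) (viaThird-cong (transfer-≢ n) a≢b)
                            (solution-bound (transfer-lexOptimal opt) a≢b sol)

corollary1 : (w : Weights)
    → (∀ a b → a ≢ b → 0ℚ ≤ℚ w a b)
    → (C : ℕ → Peg → Peg → ℚ)
    → (∀ n i j → i ≢ j → IsOptimalCost w n i j (C n i j))
    → ∀ n i j → i ≢ j
    → Optimal w n i j (wthd w C n i j)
      × (∀ ms → Optimal w n i j ms → length (wthd w C n i j) ≤ length ms)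
corollary1 w w≥0 C C-opt n i j i≢j = lexOptimal⇒optimal (wthd-lexOptimal w≥0 C-opt n i≢j)
  where
  open Lexicographic w
  open WTHD w C
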